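{- Let $A=\{a_1<a_2<\cdots\}$ and for a nonempty parking function $\mathbf a$ let $\mathbf G_{\mathbf a}(A)=\sum_{w\in A^*,\ \mathrm{Park}(w)=\mathbf a}w\in K\langle A\rangle^+$. Then the linear span of the $\mathbf G_{\mathbf a}(A)$ is a sub-dendriform trialgebra of $(K\langle A\rangle^+,\triangleleft,\circ,\triangleright)$, i.e. it is stable under the three operations, which are given by $$\mathbf G_{\mathbf a'}\triangleleft\mathbf G_{\mathbf a''}=\sum_{\mathbf a}\mathbf G_{\mathbf a}\ \ (\max(v)<\max(u)),\quad \mathbf G_{\mathbf a'}\circ\mathbf G_{\mathbf a''}=\sum_{\mathbf a}\mathbf G_{\mathbf a}\ \ (\max(v)=\max(u)),\quad \mathbf G_{\mathbf a'}\triangleright\mathbf G_{\mathbf a''}=\sum_{\mathbf a}\mathbf G_{\mathbf a}\ \ (\max(v)>\max(u)),$$ where in each case the sum runs over parking functions $\mathbf a=u\cdot v$ with $|u|=|\mathbf a'|$, $\mathrm{Park}(u)=\mathbf a'$, $\mathrm{Park}(v)=\mathbf a''$ satisfying the indicated condition (and $\mathbf G_{\mathbf a}$ stands for $\mathbf G_{\mathbf a}(A)$).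
   Context: $K$ is a field of characteristic $0$; $A=\{a_1<a_2<\cdots\}$ is an infinite totally ordered alphabet, $K\langle A\rangle$ is the projective limit of the free associative algebras $K\langle a_1,\dots,a_n\rangle$ (so infinite sums of words of bounded length are allowed), and $K\langle A\rangle^+$ is its augmentation ideal (no constant term). Words over $A$ are identified with words over positive integers via $a_i\leftrightarrow i$; $\max(w)$ is the greatest letter of $w$. For nonempty words $u,v$: $u\triangleleft v=uv$ if $\max(u)>\max(v)$ and $0$ otherwise; $u\circ v=uv$ if $\max(u)=\max(v)$ and $0$ otherwise; $u\triangleright v=uv$ if $\max(u)<\max(v)$ and $0$ otherwise; these are extended bilinearly (and to infinite sums termwise). A parking function of length $n$ is a word over $\{1,\dots,n\}$ whose nondecreasing rearrangement $a'_1\le\dots\le a'_n$ satisfies $a'_i\le i$. Parkization: for a word $w$ of length $n$, $d(w)=\min\{i\ge1: |\{j:w_j\le i\}|<i\}$; if $d(w)=n+1$ then $\mathrm{Park}(w)=w$, else $\mathrm{Park}(w)=\mathrm{Park}(w')$ with $w'$ obtained by decreasing by $1$ every letter $>d(w)$. -}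

module Defs where

open import Level using (Level)
open import Data.Nat using (ℕ; zero; suc; _⊔_; _≤ᵇ_; _<ᵇ_; _≡ᵇ_)
open import Data.Nat.ListAction using (sum)
open import Data.Bool using (Bool; T; true; false; if_then_else_; _∧_; not)
open import Data.List using (List; []; _∷_; length; take; drop; filter; map; concatMap; foldr; upTo; allFin)
open import Data.List.Membership.Propositional using (_∈_)
open import Data.Product using (_×_; _,_; ∃; ∃-syntax; Σ-syntax)
open import Relation.Binary.PropositionalEquality using (_≡_)
open import Relation.Nullary using (¬_)
open import Algebra.Bundles using (CommutativeRing)

-- Words.  The letter a_i of A is represented by the natural number i ≥ 1;
-- a word over A is a list of positive naturals.

Word : Set
Word = List ℕ

positiveᵇ : Word → Bool
positiveᵇ []      = true
positiveᵇ (x ∷ w) = (1 ≤ᵇ x) ∧ positiveᵇ w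

-- greatest letter (only used on nonempty words)
maxL : Word → ℕ
maxL = foldr _⊔_ 0

eqWᵇ : Word → Word → Bool
eqWᵇ []      []      = true
eqWᵇ (x ∷ u) (y ∷ v) = (x ≡ᵇ y) ∧ eqWᵇ u v
eqWᵇ _       _       = false

countLe : ℕ → Word → ℕ
countLe i []      = 0
countLe i (x ∷ w) = if x ≤ᵇ i then suc (countLe i w) else countLe i w

-- parking function of length n = length w: nondecreasing rearrangement
-- a'_1 ≤ … ≤ a'_n with a'_i ≤ i; equivalently (literally the same condition
-- on the sorted word) every letter lies in {1..n} and |{j : w_j ≤ i}| ≥ i for 1 ≤ i ≤ n.
insertSorted : ℕ → Word → Word
insertSorted x []      = x ∷ []
insertSorted x (y ∷ w) = if x ≤ᵇ y then x ∷ y ∷ w else y ∷ insertSorted x w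

sortW : Word → Word
sortW = foldr insertSorted []

boundedFrom : ℕ → Word → Bool
boundedFrom i []      = true
boundedFrom i (x ∷ w) = (x ≤ᵇ i) ∧ boundedFrom (suc i) w

isParkingᵇ : Word → Bool
isParkingᵇ w = positiveᵇ w ∧ boundedFrom 1 (sortW w)

-- d(w) = min { i ≥ 1 : |{j : w_j ≤ i}| < i }, searched among i = k, k+1, …, k+fuel
-- (for a word of length n the value n+1 always qualifies)
dFrom : (fuel k : ℕ) → Word → ℕ
dFrom zero       k w = k
dFrom (suc fuel) k w = if countLe k w <ᵇ k then k else dFrom fuel (suc k) w

dW : Word → ℕ
dW w = dFrom (length w) 1 w

decAbove : ℕ → Word → Word
decAbove d = map (λ x → if d <ᵇ x then Data.Nat._∸_ x 1 else x)

-- Park, iterated with fuel.  Each non-terminal step strictly decreases the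
-- sum of the letters, so fuel = sum w always suffices (Park w = parkF (sum w) w).
parkF : ℕ → Word → Word
parkF zero       w = w
parkF (suc fuel) w =
  if dW w ≡ᵇ suc (length w) then w else parkF fuel (decAbove (dW w) w)

Park : Word → Word
Park w = parkF (sum w) w

wordsOver : (n k : ℕ) → List Word
wordsOver n zero    = [] ∷ []
wordsOver n (suc k) = concatMap (λ w → map (λ x → suc x ∷ w) (upTo n)) (wordsOver n k)

PFs : ℕ → List Word
PFs n = filter (λ w → Data.Bool.T? (isParkingᵇ w)) (wordsOver n n)

module _ {c ℓ : Level} (R : CommutativeRing c ℓ) where
  open CommutativeRing R

  natR : ℕ → Carrier
  natR zero    = 0#
  natR (suc n) = 1# + natR n

  IsField : Set _
  IsField = (¬ (1# ≈ 0#)) × (∀ x → ¬ (x ≈ 0#) → ∃[ y ] (x * y ≈ 1#))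

  CharZero : Set _
  CharZero = ∀ n → ¬ (natR (suc n) ≈ 0#)

  -- K⟨A⟩ (projective limit): an element is its coefficient function on
  -- words; arbitrary (infinite) sums are allowed.  Equality is coefficientwise.

  Series : Set c
  Series = Word → Carrier

  _≈ₛ_ : Series → Series → Set _
  f ≈ₛ g = ∀ w → f w ≈ g w

  ΣR : List Carrier → Carrier
  ΣR = foldr _+_ 0#

  Augmented : Series → Set ℓ
  Augmented f = f [] ≈ 0#

  -- Bilinear extension of an operation on nonempty words u,v whose
  -- result is uv when test (max u) (max v) holds and 0 otherwise:
  -- coefficient of w in f ⋆ g is the sum over factorizations w = uv, u,v ≠ [],
  -- with test (max u) (max v), of f(u) g(v).
  splitOp : (ℕ → ℕ → Bool) → Series → Series → Series
  splitOp test f g w =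
    ΣR (map (λ k → let u = take (suc k) w ; v = drop (suc k) w in
                   if test (maxL u) (maxL v) then f u * g v else 0#)
            (Data.List.applyUpTo (λ i → i) (Data.Nat._∸_ (length w) 1)))

  _◁_ _⊙_ _▷_ : Series → Series → Series
  _◁_ = splitOp (λ m n → n <ᵇ m)
  _⊙_ = splitOp (λ m n → m ≡ᵇ n)
  _▷_ = splitOp (λ m n → m <ᵇ n)

  G : Word → Series
  G a w = if positiveᵇ w ∧ eqWᵇ (Park w) a then 1# else 0#

  sumG : List Word → Series
  sumG L w = ΣR (map (λ a → G a w) L)

  -- the parking functions a = u·v with |u| = |a'|, Park u = a', Park v = a''
  -- and test (max u) (max v)   (a ranges over PFs of length |a'| + |a''|,
  -- which is forced by the other conditions)
  factorPFs : (ℕ → ℕ → Bool) → Word → Word → List Word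
  factorPFs test a′ a″ =
    filter (λ a → Data.Bool.T?
              (let u = take (length a′) a ; v = drop (length a′) a in
               eqWᵇ (Park u) a′ ∧ eqWᵇ (Park v) a″ ∧ test (maxL u) (maxL v)))
           (PFs (Data.Nat._+_ (length a′) (length a″)))

  InSpanG : Series → Set _
  InSpanG f = ∃[ L ] ((∀ {c a} → (c , a) ∈ L →
                         T (isParkingᵇ a) × (1 Data.Nat.≤ length a))
                     × (f ≈ₛ λ w → ΣR (map (λ { (c , a) → c * G a w }) L)))

module Submission where

-- Parkization has a closed form: Park w = map (rank w) w, where rank w 0 = 0 and
-- rank w (x + 1) = 1 + min (rank w x , |{j : w_j ≤ x}|).  A reduction step of Park lowers the
-- letters above d = d(w); this d is deficient for w in a sense that passes to every prefix and
-- suffix of w and under which lowering leaves all ranks unchanged.  Hence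
-- Park (take m (Park w)) = Park (take m w), and likewise for suffixes.  As rank w is monotone and
-- strictly increasing past each letter of w, it also preserves how the maxima of two factors
-- compare.  So the coefficient of w in G a′ ⋆ G a″, a sum over the cuts of w of which only the
-- cut after |a′| letters can contribute, is the indicator that w is a word over A and that
-- Park w = u · v with the required properties: its coefficient in the sum of the G a.
-- Closure of the span then follows by bilinearity of the three operations.

open import Defs
open import Level using (Level)
open import Data.Nat using (ℕ; _≤_; _<ᵇ_; _≡ᵇ_)
open import Data.Bool using (T)
open import Data.List using (List; length)
open import Data.Product using (_×_; _,_)
open import Algebra.Bundles using (CommutativeRing)

module Parkization where

  open import Data.Nat
  open import Data.Nat.Properties
  open import Data.Nat.ListAction using (sum)
  open import Data.Bool using (Bool; true; false; if_then_else_; _∧_; T?)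
  open import Data.Bool.Properties using (∧-assoc; ∧-zeroʳ; ∧-identityʳ)
  open import Data.List using ([]; _∷_; take; drop; map; _++_; upTo; filter; concatMap)
  open import Data.List.Properties
    using (map-∘; map-cong; map-id-local; map-applyUpTo; take-map; drop-map; take++drop≡id;
           length-map; length-++; length-take; length-drop)
  open import Data.List.Relation.Unary.All as All using (All; []; _∷_)
  open import Data.List.Relation.Unary.All.Properties using (concat⁺; map⁺)
  open import Data.List.Membership.Propositional.Properties using (∈-filter⁻)
  open import Data.List.Relation.Unary.AllPairs using (AllPairs; []; _∷_)
  open import Data.List.Membership.Propositional using (_∈_)
  open import Data.List.Relation.Unary.Any using (here; there)
  open import Data.Product using (proj₁)
  open import Data.Sum using (_⊎_; inj₁; inj₂)
  open import Data.Empty using (⊥-elim)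
  open import Relation.Nullary using (yes; no)
  open import Data.List.Relation.Binary.Sublist.Propositional.Properties using (take-⊆; drop-⊆; Any-resp-⊆)
  open import Relation.Binary.Definitions using (tri<; tri≈; tri>)
  open import Relation.Binary.PropositionalEquality

  ≤ᵇ≡true⇒≤ : ∀ m n → (m ≤ᵇ n) ≡ true → m ≤ n
  ≤ᵇ≡true⇒≤ m n e = ≤ᵇ⇒≤ m n (subst T (sym e) _)

  ≤ᵇ≡false⇒> : ∀ m n → (m ≤ᵇ n) ≡ false → n < m
  ≤ᵇ≡false⇒> m n e = ≰⇒> (λ m≤n → subst T e (≤⇒≤ᵇ m≤n))

  <ᵇ≡true⇒< : ∀ m n → (m <ᵇ n) ≡ true → m < n
  <ᵇ≡true⇒< m n e = <ᵇ⇒< m n (subst T (sym e) _)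

  <ᵇ≡false⇒≥ : ∀ m n → (m <ᵇ n) ≡ false → n ≤ m
  <ᵇ≡false⇒≥ m n e = ≮⇒≥ (λ m<n → subst T e (<⇒<ᵇ m<n))

  ≡ᵇ≡true⇒≡ : ∀ m n → (m ≡ᵇ n) ≡ true → m ≡ n
  ≡ᵇ≡true⇒≡ m n e = ≡ᵇ⇒≡ m n (subst T (sym e) _)

  ≡ᵇ≡false⇒≢ : ∀ m n → (m ≡ᵇ n) ≡ false → m ≢ n
  ≡ᵇ≡false⇒≢ m n e m≡n = subst T e (≡⇒≡ᵇ m n m≡n)

  ≤⇒≤ᵇ≡true : ∀ {m n} → m ≤ n → (m ≤ᵇ n) ≡ true
  ≤⇒≤ᵇ≡true {m} {n} m≤n with m ≤ᵇ n in e
  ... | true  = refl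
  ... | false = ⊥-elim (<⇒≱ (≤ᵇ≡false⇒> m n e) m≤n)

  >⇒≤ᵇ≡false : ∀ {m n} → n < m → (m ≤ᵇ n) ≡ false
  >⇒≤ᵇ≡false {m} {n} n<m with m ≤ᵇ n in e
  ... | true  = ⊥-elim (<⇒≱ n<m (≤ᵇ≡true⇒≤ m n e))
  ... | false = refl

  <⇒<ᵇ≡true : ∀ {m n} → m < n → (m <ᵇ n) ≡ true
  <⇒<ᵇ≡true {m} {n} m<n with m <ᵇ n in e
  ... | true  = refl
  ... | false = ⊥-elim (<⇒≱ m<n (<ᵇ≡false⇒≥ m n e))

  ≥⇒<ᵇ≡false : ∀ {m n} → n ≤ m → (m <ᵇ n) ≡ false
  ≥⇒<ᵇ≡false {m} {n} n≤m with m <ᵇ n in e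
  ... | true  = ⊥-elim (<⇒≱ (<ᵇ≡true⇒< m n e) n≤m)
  ... | false = refl

  ≡⇒≡ᵇ≡true : ∀ {m n} → m ≡ n → (m ≡ᵇ n) ≡ true
  ≡⇒≡ᵇ≡true {m} {n} m≡n with m ≡ᵇ n in e
  ... | true  = refl
  ... | false = ⊥-elim (subst T e (≡⇒≡ᵇ m n m≡n))

  ≢⇒≡ᵇ≡false : ∀ {m n} → m ≢ n → (m ≡ᵇ n) ≡ false
  ≢⇒≡ᵇ≡false {m} {n} m≢n with m ≡ᵇ n in e
  ... | true  = ⊥-elim (m≢n (≡ᵇ≡true⇒≡ m n e))
  ... | false = refl

  ∧≡true⇒ˡ : ∀ {a b} → a ∧ b ≡ true → a ≡ true
  ∧≡true⇒ˡ {true} _ = refl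

  ∧≡true⇒ʳ : ∀ {a b} → a ∧ b ≡ true → b ≡ true
  ∧≡true⇒ʳ {true} e = e

  countLe-++ : ∀ i u v → countLe i (u ++ v) ≡ countLe i u + countLe i v
  countLe-++ i []      v = refl
  countLe-++ i (x ∷ u) v with x ≤ᵇ i
  ... | true  = cong suc (countLe-++ i u v)
  ... | false = countLe-++ i u v

  countLe-mono : ∀ {i j} → i ≤ j → ∀ u → countLe i u ≤ countLe j u
  countLe-mono i≤j [] = z≤n
  countLe-mono {i} {j} i≤j (x ∷ u) with x ≤ᵇ i in e₁ | x ≤ᵇ j in e₂
  ... | true  | true  = s≤s (countLe-mono i≤j u)
  ... | true  | false = ⊥-elim (<⇒≱ (≤ᵇ≡false⇒> x j e₂) (≤-trans (≤ᵇ≡true⇒≤ x i e₁) i≤j))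
  ... | false | true  = m≤n⇒m≤1+n (countLe-mono i≤j u)
  ... | false | false = countLe-mono i≤j u

  countLe≤length : ∀ i u → countLe i u ≤ length u
  countLe≤length i []      = z≤n
  countLe≤length i (x ∷ u) with x ≤ᵇ i
  ... | true  = s≤s (countLe≤length i u)
  ... | false = m≤n⇒m≤1+n (countLe≤length i u)

  countLe-full⇒All≤ : ∀ i u → length u ≤ countLe i u → All (_≤ i) u
  countLe-full⇒All≤ i []      _ = []
  countLe-full⇒All≤ i (x ∷ u) p with x ≤ᵇ i in e
  ... | true  = ≤ᵇ≡true⇒≤ x i e ∷ countLe-full⇒All≤ i u (s≤s⁻¹ p)
  ... | false = ⊥-elim (<⇒≱ (s≤s (countLe≤length i u)) p)

  countLe-∈ : ∀ t u → suc t ∈ u → countLe t u < countLe (suc t) u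
  countLe-∈ t (y ∷ u) (here refl)
    rewrite >⇒≤ᵇ≡false {suc t} {t} ≤-refl | ≤⇒≤ᵇ≡true {suc t} {suc t} ≤-refl
    = s≤s (countLe-mono (n≤1+n t) u)
  countLe-∈ t (y ∷ u) (there m) with y ≤ᵇ t in e₁ | y ≤ᵇ suc t in e₂
  ... | true  | true  = s≤s (countLe-∈ t u m)
  ... | true  | false = ⊥-elim (<⇒≱ (≤ᵇ≡false⇒> y (suc t) e₂) (m≤n⇒m≤1+n (≤ᵇ≡true⇒≤ y t e₁)))
  ... | false | true  = m≤n⇒m≤1+n (countLe-∈ t u m)
  ... | false | false = countLe-∈ t u m

  countLe-decAbove-< : ∀ {t d} → t < d → ∀ u → countLe t (decAbove d u) ≡ countLe t u
  countLe-decAbove-< t<d [] = refl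
  countLe-decAbove-< {t} {d} t<d (x ∷ u) with d <ᵇ x in e
  countLe-decAbove-< {t} {d} t<d (zero ∷ u) | true = ⊥-elim (<⇒≱ (<ᵇ≡true⇒< d zero e) z≤n)
  countLe-decAbove-< {t} {d} t<d (suc x ∷ u) | true
    rewrite >⇒≤ᵇ≡false {x} {t} (<-≤-trans t<d (s≤s⁻¹ (<ᵇ≡true⇒< d (suc x) e)))
          | >⇒≤ᵇ≡false {suc x} {t} (<-trans t<d (<ᵇ≡true⇒< d (suc x) e))
    = countLe-decAbove-< t<d u
  ... | false with x ≤ᵇ t
  ...   | true  = cong suc (countLe-decAbove-< t<d u)
  ...   | false = countLe-decAbove-< t<d u

  countLe-decAbove-≥ : ∀ {t d} → d ≤ t → ∀ u → countLe t (decAbove d u) ≡ countLe (suc t) u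
  countLe-decAbove-≥ d≤t [] = refl
  countLe-decAbove-≥ {t} {d} d≤t (x ∷ u) with d <ᵇ x in e
  countLe-decAbove-≥ {t} {d} d≤t (zero ∷ u) | true = ⊥-elim (<⇒≱ (<ᵇ≡true⇒< d zero e) z≤n)
  countLe-decAbove-≥ {t} {d} d≤t (suc x ∷ u) | true with x ≤ᵇ t in e₁ | suc x ≤ᵇ suc t in e₂
  ... | true  | true  = cong suc (countLe-decAbove-≥ d≤t u)
  ... | false | false = countLe-decAbove-≥ d≤t u
  ... | true  | false = ⊥-elim (<⇒≱ (≤ᵇ≡false⇒> (suc x) (suc t) e₂) (s≤s (≤ᵇ≡true⇒≤ x t e₁)))
  ... | false | true  = ⊥-elim (<⇒≱ (≤ᵇ≡false⇒> x t e₁) (s≤s⁻¹ (≤ᵇ≡true⇒≤ (suc x) (suc t) e₂)))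
  countLe-decAbove-≥ {t} {d} d≤t (x ∷ u) | false
    rewrite ≤⇒≤ᵇ≡true {x} {t} (≤-trans (<ᵇ≡false⇒≥ d x e) d≤t)
          | ≤⇒≤ᵇ≡true {x} {suc t} (m≤n⇒m≤1+n (≤-trans (<ᵇ≡false⇒≥ d x e) d≤t))
    = cong suc (countLe-decAbove-≥ d≤t u)

  -- rank u x = min (x , min_{t < x} (countLe t u + (x ∸ t))), cf. rank≤ and rank-glb.
  rank : Word → ℕ → ℕ
  rank u zero    = zero
  rank u (suc x) = suc (rank u x ⊓ countLe x u)

  ranked : Word → Word
  ranked u = map (rank u) u

  rank-suc≤ : ∀ u x → rank u (suc x) ≤ suc (countLe x u)
  rank-suc≤ u x = s≤s (m⊓n≤n (rank u x) (countLe x u))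

  rank≤ : ∀ u x → rank u x ≤ x
  rank≤ u zero    = z≤n
  rank≤ u (suc x) = s≤s (≤-trans (m⊓n≤m (rank u x) (countLe x u)) (rank≤ u x))

  rank-glb : ∀ u x B → B ≤ x → (∀ t → t < x → B ≤ countLe t u + (x ∸ t)) → B ≤ rank u x
  rank-glb u x       zero    _   _ = z≤n
  rank-glb u (suc x) (suc B) B≤x h = s≤s (⊓-glb (rank-glb u x B (s≤s⁻¹ B≤x) h<x) hx)
    where
    h<x : ∀ t → t < x → B ≤ countLe t u + (x ∸ t)
    h<x t t<x = s≤s⁻¹ (subst (suc B ≤_)
      (trans (cong (countLe t u +_) (+-∸-assoc 1 (<⇒≤ t<x))) (+-suc _ _)) (h t (m≤n⇒m≤1+n t<x)))
    hx : B ≤ countLe x u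
    hx = s≤s⁻¹ (subst (suc B ≤_)
      (trans (cong (λ z → countLe x u + z) (trans (+-∸-assoc 1 {x} ≤-refl) (cong suc (n∸n≡0 x))))
             (+-comm _ 1))
      (h x ≤-refl))

  Deficient : Word → ℕ → Set
  Deficient u d = suc (countLe d u) ≤ d × (∀ t → t < d → suc (countLe d u) ≤ countLe t u + (d ∸ t))

  rank-deficient : ∀ u d → Deficient u d → rank u d ≡ suc (countLe d u)
  rank-deficient u zero    (() , _)
  rank-deficient u (suc d) (cd<d , h) =
    ≤-antisym (≤-trans (rank-suc≤ u d) (s≤s (countLe-mono (n≤1+n d) u))) (rank-glb u (suc d) _ cd<d h)

  rank-decAbove-≤ : ∀ u d x → x ≤ d → rank (decAbove d u) x ≡ rank u x
  rank-decAbove-≤ u d zero    _   = refl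
  rank-decAbove-≤ u d (suc x) x<d =
    cong suc (cong₂ _⊓_ (rank-decAbove-≤ u d x (<⇒≤ x<d)) (countLe-decAbove-< x<d u))

  rank-decAbove-> : ∀ u d → Deficient u d → ∀ j → rank (decAbove d u) (d + j) ≡ rank u (suc (d + j))
  rank-decAbove-> u d def zero rewrite +-identityʳ d | rank-decAbove-≤ u d d ≤-refl | rank-deficient u d def
    = cong suc (sym (m≥n⇒m⊓n≡n (n≤1+n _)))
  rank-decAbove-> u d def (suc j) rewrite +-suc d j
    = cong suc (cong₂ _⊓_ (rank-decAbove-> u d def j) (countLe-decAbove-≥ (m≤m+n d j) u))

  ranked-decAbove : ∀ u d → Deficient u d → ranked (decAbove d u) ≡ ranked u
  ranked-decAbove u d def = trans (sym (map-∘ u)) (map-cong rank-lower u)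
    where
    rank-lower : ∀ x → rank (decAbove d u) (if d <ᵇ x then x ∸ 1 else x) ≡ rank u x
    rank-lower x with d <ᵇ x in e
    ... | false = rank-decAbove-≤ u d x (<ᵇ≡false⇒≥ d x e)
    ... | true  = subst (λ y → rank (decAbove d u) (y ∸ 1) ≡ rank u y)
                        (m+[n∸m]≡n (<ᵇ≡true⇒< d x e)) (rank-decAbove-> u d def (x ∸ suc d))

  Deficient-summand : ∀ u v w d → (∀ i → countLe i w ≡ countLe i u + countLe i v) →
                      Deficient w d → Deficient u d
  Deficient-summand u v w d split (cd<d , h) rewrite split d =
    ≤-trans (s≤s (m≤m+n _ _)) cd<d , λ t t<d → cancel (h t t<d) (countLe-mono (<⇒≤ t<d) v)
    where
    cancel : ∀ {t} → suc (countLe d u + countLe d v) ≤ countLe t w + (d ∸ t) →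
             countLe t v ≤ countLe d v → suc (countLe d u) ≤ countLe t u + (d ∸ t)
    cancel {t} p q = +-cancelʳ-≤ (countLe d v) _ _ (begin
      suc (countLe d u + countLe d v)           ≤⟨ p ⟩
      countLe t w + (d ∸ t)                     ≡⟨ cong (_+ (d ∸ t)) (split t) ⟩
      countLe t u + countLe t v + (d ∸ t)       ≤⟨ +-monoˡ-≤ (d ∸ t) (+-monoʳ-≤ (countLe t u) q) ⟩
      countLe t u + countLe d v + (d ∸ t)       ≡⟨ +-assoc (countLe t u) _ _ ⟩
      countLe t u + (countLe d v + (d ∸ t))     ≡⟨ cong (countLe t u +_) (+-comm _ (d ∸ t)) ⟩
      countLe t u + ((d ∸ t) + countLe d v)     ≡⟨ sym (+-assoc (countLe t u) _ _) ⟩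
      countLe t u + (d ∸ t) + countLe d v       ∎)
      where open ≤-Reasoning

  Deficient-++ˡ : ∀ u v d → Deficient (u ++ v) d → Deficient u d
  Deficient-++ˡ u v d = Deficient-summand u v (u ++ v) d (λ i → countLe-++ i u v)

  Deficient-++ʳ : ∀ u v d → Deficient (u ++ v) d → Deficient v d
  Deficient-++ʳ u v d =
    Deficient-summand v u (u ++ v) d (λ i → trans (countLe-++ i u v) (+-comm (countLe i u) _))

  record Factor (π : Word → Word) : Set where
    field
      map-commute : ∀ f w → π (map f w) ≡ map f (π w)
      deficient   : ∀ {w d} → Deficient w d → Deficient (π w) d
      ⊆           : ∀ {x w} → x ∈ π w → x ∈ w

  id-factor : Factor (λ w → w)
  id-factor = record { map-commute = λ _ _ → refl ; deficient = λ def → def ; ⊆ = λ x∈w → x∈w }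

  take-factor : ∀ k → Factor (take k)
  take-factor k = record
    { map-commute = λ _ w → take-map k w
    ; deficient   = λ {w} {d} def →
        Deficient-++ˡ (take k w) (drop k w) d (subst (λ z → Deficient z d) (sym (take++drop≡id k w)) def)
    ; ⊆           = λ {_} {w} → Any-resp-⊆ (take-⊆ k w)
    }

  drop-factor : ∀ k → Factor (drop k)
  drop-factor k = record
    { map-commute = λ _ w → drop-map k w
    ; deficient   = λ {w} {d} def →
        Deficient-++ʳ (take k w) (drop k w) d (subst (λ z → Deficient z d) (sym (take++drop≡id k w)) def)
    ; ⊆           = λ {_} {w} → Any-resp-⊆ (drop-⊆ k w)
    }

  NoDeficitBelow : Word → ℕ → Set
  NoDeficitBelow w r = ∀ j → 1 ≤ j → j < r → j ≤ countLe j w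

  -- the counting form of the parking condition
  Parked : Word → Set
  Parked w = NoDeficitBelow w (suc (length w))

  dFrom-spec : ∀ fuel k w → NoDeficitBelow w k →
    let d = dFrom fuel k w in
    NoDeficitBelow w d × (d ≡ k + fuel ⊎ (d < k + fuel × countLe d w < d))
  dFrom-spec zero k w below = below , inj₁ (sym (+-identityʳ k))
  dFrom-spec (suc fuel) k w below with countLe k w <ᵇ k in e
  ... | true  = below , inj₂ (m<m+n k z<s , <ᵇ≡true⇒< _ _ e)
  ... | false with dFrom-spec fuel (suc k) w below′
    where
    below′ : NoDeficitBelow w (suc k)
    below′ j 1≤j j<1+k with m≤n⇒m<n∨m≡n (s≤s⁻¹ j<1+k)
    ... | inj₁ j<k  = below j 1≤j j<k
    ... | inj₂ refl = <ᵇ≡false⇒≥ _ _ e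
  ...   | below″ , inj₁ d≡ = below″ , inj₁ (trans d≡ (sym (+-suc k fuel)))
  ...   | below″ , inj₂ (d< , deficit) =
    below″ , inj₂ (subst (dFrom fuel (suc k) w <_) (sym (+-suc k fuel)) d< , deficit)

  dW-parked : ∀ w → dW w ≡ suc (length w) → Parked w
  dW-parked w d≡ j 1≤j j≤n =
    proj₁ (dFrom-spec (length w) 1 w (λ _ 1≤j j<1 → ⊥-elim (<⇒≱ j<1 1≤j))) j 1≤j (subst (j <_) (sym d≡) j≤n)

  dW-deficient : ∀ w → dW w ≢ suc (length w) → Deficient w (dW w) × dW w ≤ length w
  dW-deficient w d≢ with dFrom-spec (length w) 1 w (λ _ 1≤j j<1 → ⊥-elim (<⇒≱ j<1 1≤j))
  ... | _ , inj₁ d≡ = ⊥-elim (d≢ d≡)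
  ... | below , inj₂ (d<1+n , deficit) = (deficit , h) , s≤s⁻¹ d<1+n
    where
    h : ∀ t → t < dW w → suc (countLe (dW w) w) ≤ countLe t w + (dW w ∸ t)
    h zero    _   = ≤-trans deficit (m≤n+m (dW w) _)
    h (suc t) t<d = ≤-trans deficit (≤-trans (≤-reflexive (sym (m+[n∸m]≡n (<⇒≤ t<d))))
                      (+-monoˡ-≤ (dW w ∸ suc t) (below (suc t) (s≤s z≤n) t<d)))

  ranked-parkF : ∀ {π} → Factor π → ∀ fuel w → ranked (π (parkF fuel w)) ≡ ranked (π w)
  ranked-parkF F zero w = refl
  ranked-parkF {π} F (suc fuel) w with dW w ≡ᵇ suc (length w) in e
  ... | true  = refl
  ... | false = begin
    ranked (π (parkF fuel (decAbove (dW w) w)))  ≡⟨ ranked-parkF F fuel (decAbove (dW w) w) ⟩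
    ranked (π (decAbove (dW w) w))               ≡⟨ cong ranked (Factor.map-commute F _ w) ⟩
    ranked (decAbove (dW w) (π w))               ≡⟨ ranked-decAbove (π w) (dW w) (Factor.deficient F def) ⟩
    ranked (π w)                                 ∎
    where
    open ≡-Reasoning
    def : Deficient w (dW w)
    def = proj₁ (dW-deficient w (≡ᵇ≡false⇒≢ _ _ e))

  sum-decAbove-≤ : ∀ d w → sum (decAbove d w) ≤ sum w
  sum-decAbove-≤ d []      = z≤n
  sum-decAbove-≤ d (x ∷ w) with d <ᵇ x
  ... | true  = +-mono-≤ (m∸n≤m x 1) (sum-decAbove-≤ d w)
  ... | false = +-monoʳ-≤ x (sum-decAbove-≤ d w)

  sum-decAbove-< : ∀ d w → countLe d w < length w → sum (decAbove d w) < sum w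
  sum-decAbove-< d (x ∷ w) p with d <ᵇ x in e
  ... | true  = +-mono-<-≤ (pred-< (<ᵇ≡true⇒< d x e)) (sum-decAbove-≤ d w)
    where
    pred-< : ∀ {x} → d < x → x ∸ 1 < x
    pred-< {suc x} _ = ≤-refl
  ... | false rewrite ≤⇒≤ᵇ≡true {x} {d} (<ᵇ≡false⇒≥ d x e) = +-monoʳ-< x (sum-decAbove-< d w (s≤s⁻¹ p))

  sum≤0⇒countLe≡length : ∀ w → sum w ≤ 0 → ∀ j → countLe j w ≡ length w
  sum≤0⇒countLe≡length []       _ j = refl
  sum≤0⇒countLe≡length (zero ∷ w) p j = cong suc (sum≤0⇒countLe≡length w p j)

  -- each non-terminal step lowers the letter sum, so fuel sum w suffices
  parkF-parked : ∀ fuel w → sum w ≤ fuel → Parked (parkF fuel w)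
  parkF-parked zero w p j _ j≤n = subst (j ≤_) (sym (sum≤0⇒countLe≡length w p j)) (s≤s⁻¹ j≤n)
  parkF-parked (suc fuel) w p with dW w ≡ᵇ suc (length w) in e
  ... | true  = dW-parked w (≡ᵇ≡true⇒≡ _ _ e)
  ... | false = parkF-parked fuel _ (s≤s⁻¹ (<-≤-trans (sum-decAbove-< (dW w) w deficit) p))
    where
    deficit : countLe (dW w) w < length w
    deficit with dW-deficient w (≡ᵇ≡false⇒≢ _ _ e)
    ... | (cd<d , _) , d≤n = <-≤-trans cd<d d≤n

  Park-parked : ∀ w → Parked (Park w)
  Park-parked w = parkF-parked (sum w) w ≤-refl

  ranked-parked : ∀ w → Parked w → ranked w ≡ w
  ranked-parked [] _ = refl
  ranked-parked w@(_ ∷ _) parked = map-id-local (fixes w letters≤n)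
    where
    n = length w
    letters≤n : All (_≤ n) w
    letters≤n = countLe-full⇒All≤ n w (parked n (s≤s z≤n) ≤-refl)
    rank-fixed : ∀ x → x ≤ n → rank w x ≡ x
    rank-fixed zero    _   = refl
    rank-fixed (suc x) x<n = ≤-antisym (rank≤ w (suc x)) (rank-glb w (suc x) (suc x) ≤-refl h)
      where
      h : ∀ t → t < suc x → suc x ≤ countLe t w + (suc x ∸ t)
      h zero    _     = m≤n+m _ _
      h (suc t) t<1+x = ≤-trans (≤-reflexive (sym (m+[n∸m]≡n (<⇒≤ t<1+x))))
        (+-monoˡ-≤ (suc x ∸ suc t) (parked (suc t) (s≤s z≤n) (s≤s (≤-trans (<⇒≤ t<1+x) x<n))))
    fixes : ∀ v → All (_≤ n) v → All (λ x → rank w x ≡ x) v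
    fixes []      []         = []
    fixes (x ∷ v) (x≤n ∷ ps) = rank-fixed x x≤n ∷ fixes v ps

  Park≡ranked : ∀ w → Park w ≡ ranked w
  Park≡ranked w = trans (sym (ranked-parked (Park w) (Park-parked w))) (ranked-parkF id-factor (sum w) w)

  Park-factor : ∀ {π} → Factor π → ∀ w → Park (π (Park w)) ≡ Park (π w)
  Park-factor {π} F w = begin
    Park (π (Park w))           ≡⟨ Park≡ranked _ ⟩
    ranked (π (parkF (sum w) w)) ≡⟨ ranked-parkF F (sum w) w ⟩
    ranked (π w)                 ≡⟨ Park≡ranked _ ⟨
    Park (π w)                   ∎
    where open ≡-Reasoning

  rank-step : ∀ u x → rank u x ≤ rank u (suc x)
  rank-step u zero    = z≤n
  rank-step u (suc x) = ≤suc-⊓ (≤-trans (rank-suc≤ u x) (s≤s (countLe-mono (n≤1+n x) u)))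
    where
    ≤suc-⊓ : ∀ {a b} → a ≤ suc b → a ≤ suc (a ⊓ b)
    ≤suc-⊓ {a} {b} a≤1+b with ≤-total a b
    ... | inj₁ a≤b = subst (λ z → a ≤ suc z) (sym (m≤n⇒m⊓n≡m a≤b)) (n≤1+n a)
    ... | inj₂ b≤a = subst (λ z → a ≤ suc z) (sym (m≥n⇒m⊓n≡n b≤a)) a≤1+b

  rank-mono : ∀ u {x y} → x ≤ y → rank u x ≤ rank u y
  rank-mono u {y = zero}  z≤n = z≤n
  rank-mono u {y = suc y} x≤1+y with m≤n⇒m<n∨m≡n x≤1+y
  ... | inj₁ x<1+y = ≤-trans (rank-mono u (s≤s⁻¹ x<1+y)) (rank-step u y)
  ... | inj₂ refl  = ≤-refl

  rank-strict : ∀ w {x y} → x ∈ 0 ∷ w → x < y → rank w x < rank w y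
  rank-strict w {x} x∈ x<y = ≤-trans (≤-reflexive (cong suc (sym (m≤n⇒m⊓n≡m (rank≤countLe x x∈)))))
                                      (rank-mono w x<y)
    where
    rank≤countLe : ∀ x → x ∈ 0 ∷ w → rank w x ≤ countLe x w
    rank≤countLe zero    _               = z≤n
    rank≤countLe (suc x) (there 1+x∈w) = ≤-trans (rank-suc≤ w x) (countLe-∈ x w 1+x∈w)

  -- 0 is admitted because it is the maximum of an empty factor
  PreservedByRank : (ℕ → ℕ → Bool) → Set
  PreservedByRank test = ∀ w x y → x ∈ 0 ∷ w → y ∈ 0 ∷ w → test (rank w x) (rank w y) ≡ test x y

  <ᵇ-preserved : PreservedByRank _<ᵇ_
  <ᵇ-preserved w x y x∈ y∈ with <-cmp x y
  ... | tri< x<y _ _ = trans (<⇒<ᵇ≡true (rank-strict w x∈ x<y)) (sym (<⇒<ᵇ≡true x<y))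
  ... | tri≈ _ refl _ = trans (≥⇒<ᵇ≡false {rank w x} ≤-refl) (sym (≥⇒<ᵇ≡false {x} ≤-refl))
  ... | tri> _ _ y<x = trans (≥⇒<ᵇ≡false (<⇒≤ (rank-strict w y∈ y<x))) (sym (≥⇒<ᵇ≡false (<⇒≤ y<x)))

  >ᵇ-preserved : PreservedByRank (λ m n → n <ᵇ m)
  >ᵇ-preserved w x y x∈ y∈ = <ᵇ-preserved w y x y∈ x∈

  ≡ᵇ-preserved : PreservedByRank _≡ᵇ_
  ≡ᵇ-preserved w x y x∈ y∈ with <-cmp x y
  ... | tri< x<y _ _ = trans (≢⇒≡ᵇ≡false (<⇒≢ (rank-strict w x∈ x<y))) (sym (≢⇒≡ᵇ≡false (<⇒≢ x<y)))
  ... | tri≈ _ refl _ = trans (≡⇒≡ᵇ≡true {rank w x} refl) (sym (≡⇒≡ᵇ≡true {x} refl))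
  ... | tri> _ _ y<x = trans (≢⇒≡ᵇ≡false (≢-sym (<⇒≢ (rank-strict w y∈ y<x))))
                             (sym (≢⇒≡ᵇ≡false (≢-sym (<⇒≢ y<x))))

  maxL-ranked : ∀ w v → maxL (map (rank w) v) ≡ rank w (maxL v)
  maxL-ranked w []      = refl
  maxL-ranked w (x ∷ v) = trans (cong (rank w x ⊔_) (maxL-ranked w v))
                                (sym (mono-≤-distrib-⊔ (rank-mono w) x (maxL v)))

  maxL∈ : ∀ v → maxL v ∈ 0 ∷ v
  maxL∈ []      = here refl
  maxL∈ (x ∷ v) with ≤-total x (maxL v)
  ... | inj₁ x≤m = subst (_∈ 0 ∷ x ∷ v) (sym (m≤n⇒m⊔n≡n x≤m)) (widen (maxL∈ v))
    where
    widen : ∀ {y} → y ∈ 0 ∷ v → y ∈ 0 ∷ x ∷ v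
    widen (here y≡0) = here y≡0
    widen (there y∈v) = there (there y∈v)
  ... | inj₂ m≤x = subst (_∈ 0 ∷ x ∷ v) (sym (m≥n⇒m⊔n≡m m≤x)) (there (here refl))

  test-Park : ∀ {test} → PreservedByRank test → ∀ {π ρ} → Factor π → Factor ρ → ∀ w →
              test (maxL (π (Park w))) (maxL (ρ (Park w))) ≡ test (maxL (π w)) (maxL (ρ w))
  test-Park {test} preserved {π} {ρ} Fπ Fρ w = begin
    test (maxL (π (Park w))) (maxL (ρ (Park w)))
      ≡⟨ cong (λ z → test (maxL (π z)) (maxL (ρ z))) (Park≡ranked w) ⟩
    test (maxL (π (ranked w))) (maxL (ρ (ranked w)))
      ≡⟨ cong₂ test (maxL-factor Fπ) (maxL-factor Fρ) ⟩
    test (rank w (maxL (π w))) (rank w (maxL (ρ w)))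
      ≡⟨ preserved w _ _ (letter Fπ) (letter Fρ) ⟩
    test (maxL (π w)) (maxL (ρ w)) ∎
    where
    open ≡-Reasoning
    maxL-factor : ∀ {σ} → Factor σ → maxL (σ (ranked w)) ≡ rank w (maxL (σ w))
    maxL-factor {σ} F = trans (cong maxL (Factor.map-commute F (rank w) w)) (maxL-ranked w (σ w))
    letter : ∀ {σ} → Factor σ → maxL (σ w) ∈ 0 ∷ w
    letter {σ} F with maxL∈ (σ w)
    ... | here m≡0  = here m≡0
    ... | there m∈ = there (Factor.⊆ F m∈)

  Park-length : ∀ w → length (Park w) ≡ length w
  Park-length w = trans (cong length (Park≡ranked w)) (length-map (rank w) w)

  positiveᵇ-++ : ∀ u v → positiveᵇ (u ++ v) ≡ positiveᵇ u ∧ positiveᵇ v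
  positiveᵇ-++ []      v = refl
  positiveᵇ-++ (x ∷ u) v rewrite positiveᵇ-++ u v = sym (∧-assoc (1 ≤ᵇ x) (positiveᵇ u) (positiveᵇ v))

  positiveᵇ-take-drop : ∀ k w → positiveᵇ w ≡ positiveᵇ (take k w) ∧ positiveᵇ (drop k w)
  positiveᵇ-take-drop k w =
    trans (cong positiveᵇ (sym (take++drop≡id k w))) (positiveᵇ-++ (take k w) (drop k w))

  positiveᵇ⇒All : ∀ v → positiveᵇ v ≡ true → All (1 ≤_) v
  positiveᵇ⇒All []          _ = []
  positiveᵇ⇒All (suc x ∷ v) p = s≤s z≤n ∷ positiveᵇ⇒All v p

  Park-positive : ∀ w → positiveᵇ w ≡ true → positiveᵇ (Park w) ≡ true
  Park-positive w p rewrite Park≡ranked w = ranks-positive w p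
    where
    ranks-positive : ∀ v → positiveᵇ v ≡ true → positiveᵇ (map (rank w) v) ≡ true
    ranks-positive []          _ = refl
    ranks-positive (suc x ∷ v) p = ranks-positive v p

  Park-letters : ∀ w → positiveᵇ w ≡ true → All (λ y → 1 ≤ y × y ≤ length w) (Park w)
  Park-letters []         _ = []
  Park-letters w@(_ ∷ _) p =
    All.zip ( positiveᵇ⇒All (Park w) (Park-positive w p)
            , subst (λ n → All (_≤ n) (Park w)) (Park-length w) letters≤n)
    where
    n = length (Park w)
    letters≤n : All (_≤ n) (Park w)
    letters≤n = countLe-full⇒All≤ n (Park w)
      (Park-parked w n (subst (1 ≤_) (sym (Park-length w)) (s≤s z≤n)) ≤-refl)

  countLe-insertSorted : ∀ j x s → countLe j (insertSorted x s) ≡ countLe j (x ∷ s)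
  countLe-insertSorted j x []      = refl
  countLe-insertSorted j x (y ∷ s) with x ≤ᵇ y
  ... | true  = refl
  ... | false rewrite countLe-insertSorted j x s with y ≤ᵇ j | x ≤ᵇ j
  ...   | true  | true  = refl
  ...   | true  | false = refl
  ...   | false | true  = refl
  ...   | false | false = refl

  countLe-sortW : ∀ j v → countLe j (sortW v) ≡ countLe j v
  countLe-sortW j []      = refl
  countLe-sortW j (x ∷ v) rewrite countLe-insertSorted j x (sortW v) with x ≤ᵇ j
  ... | true  = cong suc (countLe-sortW j v)
  ... | false = countLe-sortW j v

  length-sortW : ∀ v → length (sortW v) ≡ length v
  length-sortW []      = refl
  length-sortW (x ∷ v) = trans (length-insert x (sortW v)) (cong suc (length-sortW v))
    where
    length-insert : ∀ x s → length (insertSorted x s) ≡ suc (length s)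
    length-insert x []      = refl
    length-insert x (y ∷ s) with x ≤ᵇ y
    ... | true  = refl
    ... | false = cong suc (length-insert x s)

  Sorted : Word → Set
  Sorted = AllPairs _≤_

  insertSorted-sorted : ∀ x s → Sorted s → Sorted (insertSorted x s)
  insertSorted-sorted x []      _              = [] ∷ []
  insertSorted-sorted x (y ∷ s) (y≤s ∷ sorted) with x ≤ᵇ y in e
  ... | true  = (x≤y ∷ All.map (≤-trans x≤y) y≤s) ∷ y≤s ∷ sorted
    where x≤y = ≤ᵇ≡true⇒≤ x y e
  ... | false = insert-≥ s y≤s ∷ insertSorted-sorted x s sorted
    where
    insert-≥ : ∀ s → All (y ≤_) s → All (y ≤_) (insertSorted x s)
    insert-≥ []      []             = <⇒≤ (≤ᵇ≡false⇒> x y e) ∷ []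
    insert-≥ (z ∷ s) (y≤z ∷ y≤s) with x ≤ᵇ z
    ... | true  = <⇒≤ (≤ᵇ≡false⇒> x y e) ∷ y≤z ∷ y≤s
    ... | false = y≤z ∷ insert-≥ s y≤s

  sortW-sorted : ∀ v → Sorted (sortW v)
  sortW-sorted []      = []
  sortW-sorted (x ∷ v) = insertSorted-sorted x (sortW v) (sortW-sorted v)

  boundedFrom-sorted : ∀ i s → Sorted s →
    (∀ j → i ≤ j → j < i + length s → suc (j ∸ i) ≤ countLe j s) → boundedFrom i s ≡ true
  boundedFrom-sorted i []      _               _ = refl
  boundedFrom-sorted i (x ∷ s) (x≤s ∷ sorted) h =
    cong₂ _∧_ (≤⇒≤ᵇ≡true x≤i) (boundedFrom-sorted (suc i) s sorted h′)
    where
    none≤ : ∀ {i} → i < x → ∀ s → All (x ≤_) s → countLe i s ≡ 0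
    none≤ i<x []      []           = refl
    none≤ i<x (z ∷ s) (x≤z ∷ x≤s) rewrite >⇒≤ᵇ≡false (<-≤-trans i<x x≤z) = none≤ i<x s x≤s
    x≤i : x ≤ i
    x≤i with x ≤? i
    ... | yes x≤i = x≤i
    ... | no  x≰i = ⊥-elim (<⇒≱ (≤-trans (s≤s (≤-reflexive (sym (n∸n≡0 i)))) (h i ≤-refl (m<m+n i z<s)))
                                 (≤-reflexive (none≤ (≰⇒> x≰i) (x ∷ s) (≤-refl ∷ x≤s))))
    h′ : ∀ j → suc i ≤ j → j < suc i + length s → suc (j ∸ suc i) ≤ countLe j s
    h′ j i<j j<i+n with h j (<⇒≤ i<j) (subst (j <_) (sym (+-suc i (length s))) j<i+n)
    ... | r rewrite ≤⇒≤ᵇ≡true (≤-trans x≤i (<⇒≤ i<j)) =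
      s≤s⁻¹ (subst (λ z → suc z ≤ suc (countLe j s)) (+-∸-assoc 1 i<j) r)

  parked⇒isParkingᵇ : ∀ v → positiveᵇ v ≡ true → Parked v → isParkingᵇ v ≡ true
  parked⇒isParkingᵇ v positive parked rewrite positive =
    boundedFrom-sorted 1 (sortW v) (sortW-sorted v) h
    where
    h : ∀ j → 1 ≤ j → j < 1 + length (sortW v) → suc (j ∸ 1) ≤ countLe j (sortW v)
    h (suc j) _ j<1+n rewrite countLe-sortW (suc j) v =
      parked (suc j) (s≤s z≤n) (subst (suc j <_) (cong suc (length-sortW v)) j<1+n)

  Park-isParkingᵇ : ∀ w → positiveᵇ w ≡ true → isParkingᵇ (Park w) ≡ true
  Park-isParkingᵇ w p = parked⇒isParkingᵇ (Park w) (Park-positive w p) (Park-parked w)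

  eqWᵇ⇒≡ : ∀ p a → eqWᵇ p a ≡ true → p ≡ a
  eqWᵇ⇒≡ []      []      _ = refl
  eqWᵇ⇒≡ (x ∷ p) (y ∷ a) e = cong₂ _∷_ (≡ᵇ≡true⇒≡ x y (∧≡true⇒ˡ e)) (eqWᵇ⇒≡ p a (∧≡true⇒ʳ {x ≡ᵇ y} e))

  factorsAs : (ℕ → ℕ → Bool) → Word → Word → Word → Bool
  factorsAs test a′ a″ a =
    eqWᵇ (Park (take (length a′) a)) a′ ∧ eqWᵇ (Park (drop (length a′) a)) a″ ∧
    test (maxL (take (length a′) a)) (maxL (drop (length a′) a))

  factorsAs-Park : ∀ {test} → PreservedByRank test → ∀ a′ a″ w →
                   factorsAs test a′ a″ (Park w) ≡ factorsAs test a′ a″ w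
  factorsAs-Park preserved a′ a″ w
    rewrite Park-factor (take-factor (length a′)) w | Park-factor (drop-factor (length a′)) w
          | test-Park preserved (take-factor (length a′)) (drop-factor (length a′)) w = refl

  factorsAs⇒length : ∀ test a′ a″ w → factorsAs test a′ a″ w ≡ true → length w ≡ length a′ + length a″
  factorsAs⇒length test a′ a″ w e = begin
    length w                                      ≡⟨ cong length (take++drop≡id m w) ⟨
    length (take m w ++ drop m w)                 ≡⟨ length-++ (take m w) ⟩
    length (take m w) + length (drop m w)         ≡⟨ cong₂ _+_ (factor-length a′ (take m w) (∧≡true⇒ˡ e))
                                                               (factor-length a″ (drop m w) Park-v≡a″) ⟩
    length a′ + length a″                         ∎
    where
    open ≡-Reasoning
    m = length a′
    Park-v≡a″ = ∧≡true⇒ˡ (∧≡true⇒ʳ {eqWᵇ (Park (take m w)) a′} e)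
    factor-length : ∀ a u → eqWᵇ (Park u) a ≡ true → length u ≡ length a
    factor-length a u eq = trans (sym (Park-length u)) (cong length (eqWᵇ⇒≡ (Park u) a eq))

  multiplicity : Word → List Word → ℕ
  multiplicity p []      = 0
  multiplicity p (a ∷ L) = if eqWᵇ p a then suc (multiplicity p L) else multiplicity p L

  occurrences : ℕ → List ℕ → ℕ
  occurrences y []      = 0
  occurrences y (x ∷ L) = if y ≡ᵇ x then suc (occurrences y L) else occurrences y L

  multiplicity-++ : ∀ p L₁ L₂ → multiplicity p (L₁ ++ L₂) ≡ multiplicity p L₁ + multiplicity p L₂
  multiplicity-++ p []      L₂ = refl
  multiplicity-++ p (a ∷ L₁) L₂ with eqWᵇ p a
  ... | true  = cong suc (multiplicity-++ p L₁ L₂)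
  ... | false = multiplicity-++ p L₁ L₂

  multiplicity-filter : ∀ (P : Word → Bool) p L →
    multiplicity p (filter (λ a → T? (P a)) L) ≡ (if P p then multiplicity p L else 0)
  multiplicity-filter P p [] with P p
  ... | true  = refl
  ... | false = refl
  multiplicity-filter P p (a ∷ L) with P a in e₁ | eqWᵇ p a in e₂
  ... | true  | false rewrite e₂ = multiplicity-filter P p L
  ... | false | false = multiplicity-filter P p L
  ... | true  | true  with refl ← eqWᵇ⇒≡ p a e₂ rewrite e₁ | e₂ =
    cong suc (trans (multiplicity-filter P p L) (cong (λ b → if b then multiplicity p L else 0) e₁))
  ... | false | true  with refl ← eqWᵇ⇒≡ p a e₂ rewrite e₁ =
    trans (multiplicity-filter P p L) (cong (λ b → if b then multiplicity p L else 0) e₁)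

  occurrences-map-suc : ∀ y L → occurrences (suc y) (map suc L) ≡ occurrences y L
  occurrences-map-suc y []      = refl
  occurrences-map-suc y (x ∷ L) with y ≡ᵇ x
  ... | true  = cong suc (occurrences-map-suc y L)
  ... | false = occurrences-map-suc y L

  occurrences-upTo : ∀ {y n} → y < n → occurrences y (upTo n) ≡ 1
  occurrences-upTo {y} {suc n} y<1+n =
    trans (cong (occurrences y) (cong (0 ∷_) (sym (map-applyUpTo (λ i → i) suc n)))) (first-or-later y y<1+n)
    where
    occurrences-0 : ∀ L → occurrences 0 (map suc L) ≡ 0
    occurrences-0 []      = refl
    occurrences-0 (x ∷ L) = occurrences-0 L
    first-or-later : ∀ y → y < suc n → occurrences y (0 ∷ map suc (upTo n)) ≡ 1
    first-or-later zero    _       = cong suc (occurrences-0 (upTo n))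
    first-or-later (suc y) 1+y<1+n = trans (occurrences-map-suc y (upTo n)) (occurrences-upTo (s≤s⁻¹ 1+y<1+n))

  multiplicity-prepend : ∀ y p w L →
    multiplicity (y ∷ p) (map (λ x → suc x ∷ w) L) ≡ (if eqWᵇ p w then occurrences y (map suc L) else 0)
  multiplicity-prepend y p w [] with eqWᵇ p w
  ... | true  = refl
  ... | false = refl
  multiplicity-prepend y p w (x ∷ L) rewrite multiplicity-prepend y p w L with eqWᵇ p w | y ≡ᵇ suc x
  ... | true  | true  = refl
  ... | true  | false = refl
  ... | false | true  = refl
  ... | false | false = refl

  -- wordsOver n (suc k) is definitionally concatMap (extend n) (wordsOver n k)
  extend : ℕ → Word → List Word
  extend n w = map (λ x → suc x ∷ w) (upTo n)

  multiplicity-[]-extend : ∀ n W → multiplicity [] (concatMap (extend n) W) ≡ 0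
  multiplicity-[]-extend n []      = refl
  multiplicity-[]-extend n (w ∷ W) =
    trans (multiplicity-++ [] (extend n w) (concatMap (extend n) W))
          (cong₂ _+_ (none (upTo n)) (multiplicity-[]-extend n W))
    where
    none : ∀ L → multiplicity [] (map (λ x → suc x ∷ w) L) ≡ 0
    none []      = refl
    none (x ∷ L) = none L

  multiplicity-∷-extend : ∀ y p n W → y < n →
    multiplicity (suc y ∷ p) (concatMap (extend n) W) ≡ multiplicity p W
  multiplicity-∷-extend y p n []      _   = refl
  multiplicity-∷-extend y p n (w ∷ W) y<n
    rewrite multiplicity-++ (suc y ∷ p) (extend n w) (concatMap (extend n) W)
          | multiplicity-prepend (suc y) p w (upTo n) | multiplicity-∷-extend y p n W y<n
    with eqWᵇ p w
  ... | true  = cong (_+ multiplicity p W) (trans (occurrences-map-suc y (upTo n)) (occurrences-upTo y<n))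
  ... | false = refl

  multiplicity-wordsOver : ∀ n k p → All (λ y → 1 ≤ y × y ≤ n) p →
    multiplicity p (wordsOver n k) ≡ (if length p ≡ᵇ k then 1 else 0)
  multiplicity-wordsOver n zero    []      _ = refl
  multiplicity-wordsOver n zero    (_ ∷ _) _ = refl
  multiplicity-wordsOver n (suc k) []      _ = multiplicity-[]-extend n (wordsOver n k)
  multiplicity-wordsOver n (suc k) (suc y ∷ p) ((_ , 1+y≤n) ∷ letters) =
    trans (multiplicity-∷-extend y p n (wordsOver n k) 1+y≤n) (multiplicity-wordsOver n k p letters)

  multiplicity-Park-factors : ∀ {test} → PreservedByRank test → ∀ a′ a″ w → positiveᵇ w ≡ true →
    multiplicity (Park w) (filter (λ a → T? (factorsAs test a′ a″ a)) (PFs (length a′ + length a″)))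
      ≡ (if factorsAs test a′ a″ w then 1 else 0)
  multiplicity-Park-factors {test} preserved a′ a″ w positive
    rewrite multiplicity-filter (factorsAs test a′ a″) (Park w) (PFs (length a′ + length a″))
          | factorsAs-Park preserved a′ a″ w
    with factorsAs test a′ a″ w in e
  ... | false = refl
  ... | true  rewrite sym (factorsAs⇒length test a′ a″ w e)
                    | multiplicity-filter isParkingᵇ (Park w) (wordsOver (length w) (length w))
                    | Park-isParkingᵇ w positive
                    | multiplicity-wordsOver (length w) (length w) (Park w) (Park-letters w positive)
                    | Park-length w
                    | ≡⇒≡ᵇ≡true {length w} refl = refl

  -- whether cutting w after j letters contributes to the coefficient of w in G a′ ⋆ G a″
  cutAt : (ℕ → ℕ → Bool) → Word → Word → ℕ → Word → Bool
  cutAt test a′ a″ j w =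
    test (maxL (take j w)) (maxL (drop j w)) ∧
    ((positiveᵇ (take j w) ∧ eqWᵇ (Park (take j w)) a′) ∧ (positiveᵇ (drop j w) ∧ eqWᵇ (Park (drop j w)) a″))

  cutAt⇒≡length : ∀ test a′ a″ j w → cutAt test a′ a″ j w ≡ true → j ≤ length w → j ≡ length a′
  cutAt⇒≡length test a′ a″ j w e j≤n = begin
    j                         ≡⟨ m≤n⇒m⊓n≡m j≤n ⟨
    j ⊓ length w              ≡⟨ length-take j w ⟨
    length (take j w)         ≡⟨ Park-length (take j w) ⟨
    length (Park (take j w))  ≡⟨ cong length (eqWᵇ⇒≡ (Park (take j w)) a′ Park≡a′) ⟩
    length a′                 ∎
    where
    open ≡-Reasoning
    Park≡a′ = ∧≡true⇒ʳ {positiveᵇ (take j w)}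
                (∧≡true⇒ˡ (∧≡true⇒ʳ {test (maxL (take j w)) (maxL (drop j w))} e))

  ∧-false : ∀ l t → l ∧ (t ∧ false) ≡ false
  ∧-false l t rewrite ∧-zeroʳ t = ∧-zeroʳ l

  ∧-rearrange : ∀ l t pu e₁ pv e₂ → (e₂ ≡ true → l ≡ true) →
                l ∧ (t ∧ ((pu ∧ e₁) ∧ (pv ∧ e₂))) ≡ (pu ∧ pv) ∧ (e₁ ∧ e₂ ∧ t)
  ∧-rearrange l t false e₁    pv    e₂    _ = ∧-false l t
  ∧-rearrange l t true  e₁    false e₂    _ rewrite ∧-zeroʳ e₁ = ∧-false l t
  ∧-rearrange l t true  false true  e₂    _ = ∧-false l t
  ∧-rearrange l t true  true  true  false _ = ∧-false l t
  ∧-rearrange l t true  true  true  true  h rewrite h refl = ∧-identityʳ t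

  cutAt-length≡factorsAs : ∀ test a′ a″ m₀ w → length a′ ≡ suc m₀ → 1 ≤ length a″ →
    (m₀ <ᵇ length w ∸ 1) ∧ cutAt test a′ a″ (length a′) w ≡ positiveᵇ w ∧ factorsAs test a′ a″ w
  cutAt-length≡factorsAs test a′ a″ m₀ w m≡ 1≤n″ rewrite positiveᵇ-take-drop (length a′) w =
    ∧-rearrange (m₀ <ᵇ length w ∸ 1) (test (maxL u) (maxL v)) (positiveᵇ u) (eqWᵇ (Park u) a′)
                (positiveᵇ v) (eqWᵇ (Park v) a″) cut-fits
    where
    u = take (length a′) w
    v = drop (length a′) w
    cut-fits : eqWᵇ (Park v) a″ ≡ true → (m₀ <ᵇ length w ∸ 1) ≡ true
    cut-fits e = <⇒<ᵇ≡true (∸-monoˡ-< (subst (_< length w) m≡ m<n) (s≤s z≤n))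
      where
      |v|≡ : length a″ ≡ length w ∸ length a′
      |v|≡ = begin
        length a″         ≡⟨ cong length (eqWᵇ⇒≡ (Park v) a″ e) ⟨
        length (Park v)   ≡⟨ Park-length v ⟩
        length v          ≡⟨ length-drop (length a′) w ⟩
        length w ∸ length a′ ∎
        where open ≡-Reasoning
      m<n : length a′ < length w
      m<n = m∸n≢0⇒n<m (>⇒≢ (subst (1 ≤_) |v|≡ 1≤n″))

  wordsOver-length : ∀ n k → All (λ v → length v ≡ k) (wordsOver n k)
  wordsOver-length n zero    = refl ∷ []
  wordsOver-length n (suc k) = concat⁺ (map⁺ (All.map extend-length (wordsOver-length n k)))
    where
    extend-length : ∀ {w} → length w ≡ k → All (λ v → length v ≡ suc k) (extend n w)
    extend-length |w|≡k = map⁺ (All.universal (λ _ → cong suc |w|≡k) (upTo n))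

  ∈-PFs : ∀ {n a} → a ∈ PFs n → T (isParkingᵇ a) × length a ≡ n
  ∈-PFs {n} a∈ with ∈-filter⁻ (λ a → T? (isParkingᵇ a)) a∈
  ... | a∈words , parking = parking , All.lookup (wordsOver-length n n) a∈words

module Coefficients {c ℓ : Level} (K : CommutativeRing c ℓ) where

  open Parkization
  open import Function using (_∘_)
  open import Data.Product using (proj₁; proj₂; map₁)
  open import Data.List.Relation.Unary.All as All using (All; []; _∷_)
  open import Data.List.Relation.Unary.All.Properties using (++⁺; map⁺)
  open import Data.List.Membership.Propositional using (_∈_)
  open import Data.List.Membership.Propositional.Properties using (∈-filter⁻)
  open import Data.Nat using (zero; suc; _<_; _∸_; s≤s; z≤n)
  open import Data.Nat.Properties using (suc-injective; ≤-trans; m∸n≤m; m≤m+n)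
  open import Data.Bool using (Bool; true; false; if_then_else_; _∧_; T?)
  open import Data.List using ([]; _∷_; take; drop; map; _++_; applyUpTo)
  open import Data.Empty using (⊥-elim)
  open import Relation.Binary.PropositionalEquality as ≡ using (_≡_; _≢_; subst)
  open import Algebra.Properties.CommutativeSemigroup using (interchange; x∙yz≈y∙xz)
  open CommutativeRing K hiding (zero)
  open import Relation.Binary.Reasoning.Setoid setoid

  indicator : Bool → Carrier
  indicator b = if b then 1# else 0#

  indicator-∧ : ∀ a b → indicator a * indicator b ≈ indicator (a ∧ b)
  indicator-∧ true  true  = *-identityˡ 1#
  indicator-∧ true  false = zeroʳ 1#
  indicator-∧ false b     = zeroˡ (indicator b)

  if-indicator : ∀ t {x} b → x ≈ indicator b → (if t then x else 0#) ≈ indicator (t ∧ b)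
  if-indicator true  b x≈ = x≈
  if-indicator false b _  = refl

  natR-indicator : ∀ b → natR K (if b then 1 else 0) ≈ indicator b
  natR-indicator true  = +-identityʳ 1#
  natR-indicator false = refl

  ΣR-cong : ∀ {A : Set} {h₁ h₂ : A → Carrier} (l : List A) → (∀ k → h₁ k ≈ h₂ k) →
            ΣR K (map h₁ l) ≈ ΣR K (map h₂ l)
  ΣR-cong []      _ = refl
  ΣR-cong (x ∷ l) p = +-cong (p x) (ΣR-cong l p)

  ΣR-+ : ∀ {A : Set} (h₁ h₂ : A → Carrier) (l : List A) →
         ΣR K (map (λ k → h₁ k + h₂ k) l) ≈ ΣR K (map h₁ l) + ΣR K (map h₂ l)
  ΣR-+ h₁ h₂ []      = sym (+-identityʳ 0#)
  ΣR-+ h₁ h₂ (x ∷ l) = trans (+-congˡ (ΣR-+ h₁ h₂ l)) (interchange +-commutativeSemigroup _ _ _ _)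

  ΣR-* : ∀ {A : Set} (e : Carrier) (h : A → Carrier) (l : List A) →
         ΣR K (map (λ k → e * h k) l) ≈ e * ΣR K (map h l)
  ΣR-* e h []      = sym (zeroʳ e)
  ΣR-* e h (x ∷ l) = trans (+-congˡ (ΣR-* e h l)) (sym (distribˡ e (h x) _))

  ΣR-0 : ∀ {A : Set} {h : A → Carrier} (l : List A) → (∀ k → h k ≈ 0#) → ΣR K (map h l) ≈ 0#
  ΣR-0 []      _ = refl
  ΣR-0 (x ∷ l) p = trans (+-cong (p x) (ΣR-0 l p)) (+-identityʳ 0#)

  ΣR-applyUpTo-0 : ∀ (h : ℕ → Carrier) (f : ℕ → ℕ) N → (∀ i → i < N → h (f i) ≈ 0#) →
                   ΣR K (map h (applyUpTo f N)) ≈ 0#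
  ΣR-applyUpTo-0 h f zero    _    = refl
  ΣR-applyUpTo-0 h f (suc N) vanish = trans (+-cong (vanish 0 (s≤s z≤n))
    (ΣR-applyUpTo-0 h (λ x → f (suc x)) N (λ i i<N → vanish (suc i) (s≤s i<N)))) (+-identityʳ 0#)

  ΣR-single : ∀ (h : ℕ → Carrier) (f : ℕ → ℕ) N i₀ → (∀ i → i < N → i ≢ i₀ → h (f i) ≈ 0#) →
              ΣR K (map h (applyUpTo f N)) ≈ (if i₀ <ᵇ N then h (f i₀) else 0#)
  ΣR-single h f zero    i₀       _    = refl
  ΣR-single h f (suc N) zero     off = begin
    h (f 0) + ΣR K (map h (applyUpTo (λ x → f (suc x)) N))
      ≈⟨ +-congˡ (ΣR-applyUpTo-0 h (λ x → f (suc x)) N (λ i i<N → off (suc i) (s≤s i<N) (λ ()))) ⟩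
    h (f 0) + 0#
      ≈⟨ +-identityʳ _ ⟩
    h (f 0) ∎
  ΣR-single h f (suc N) (suc i₀) off = begin
    h (f 0) + ΣR K (map h (applyUpTo (λ x → f (suc x)) N))
      ≈⟨ +-cong (off 0 (s≤s z≤n) (λ ())) (ΣR-single h (λ x → f (suc x)) N i₀
                 (λ i i<N i≢ → off (suc i) (s≤s i<N) (λ e → i≢ (suc-injective e)))) ⟩
    0# + (if i₀ <ᵇ N then h (f (suc i₀)) else 0#)
      ≈⟨ +-identityˡ _ ⟩
    (if i₀ <ᵇ N then h (f (suc i₀)) else 0#) ∎

  ΣR-multiplicity : ∀ p L → ΣR K (map (λ a → indicator (eqWᵇ p a)) L) ≈ natR K (multiplicity p L)
  ΣR-multiplicity p []      = refl
  ΣR-multiplicity p (a ∷ L) with eqWᵇ p a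
  ... | true  = +-congˡ (ΣR-multiplicity p L)
  ... | false = trans (+-identityˡ _) (ΣR-multiplicity p L)

  splitOp-G : ∀ test a′ a″ → 1 ≤ length a′ → 1 ≤ length a″ → ∀ w →
              splitOp K test (G K a′) (G K a″) w ≈ indicator (positiveᵇ w ∧ factorsAs test a′ a″ w)
  splitOp-G test a′@(_ ∷ a₀) a″ _ 1≤n″ w = begin
    splitOp K test (G K a′) (G K a″) w
      ≈⟨ ΣR-single term (λ i → i) (length w ∸ 1) (length a₀) off-cut ⟩
    (if length a₀ <ᵇ length w ∸ 1 then term (length a₀) else 0#)
      ≈⟨ if-indicator (length a₀ <ᵇ length w ∸ 1) _ (term≈ (length a₀)) ⟩
    indicator ((length a₀ <ᵇ length w ∸ 1) ∧ cutAt test a′ a″ (length a′) w)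
      ≡⟨ ≡.cong indicator (cutAt-length≡factorsAs test a′ a″ (length a₀) w ≡.refl 1≤n″) ⟩
    indicator (positiveᵇ w ∧ factorsAs test a′ a″ w) ∎
    where
    term : ℕ → Carrier
    term k = if test (maxL (take (suc k) w)) (maxL (drop (suc k) w))
               then G K a′ (take (suc k) w) * G K a″ (drop (suc k) w) else 0#
    term≈ : ∀ k → term k ≈ indicator (cutAt test a′ a″ (suc k) w)
    term≈ k = if-indicator (test (maxL (take (suc k) w)) (maxL (drop (suc k) w))) _
                (indicator-∧ (positiveᵇ (take (suc k) w) ∧ eqWᵇ (Park (take (suc k) w)) a′) _)
    off-cut : ∀ k → k < length w ∸ 1 → k ≢ length a₀ → term k ≈ 0#
    off-cut k k<n k≢ with cutAt test a′ a″ (suc k) w in e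
    ... | true  = ⊥-elim (k≢ (suc-injective
                    (cutAt⇒≡length test a′ a″ (suc k) w e (≤-trans k<n (m∸n≤m _ 1)))))
    ... | false = trans (term≈ k) (reflexive (≡.cong indicator e))

  sumG-factorPFs : ∀ {test} → PreservedByRank test → ∀ a′ a″ w →
                   sumG K (factorPFs K test a′ a″) w ≈ indicator (positiveᵇ w ∧ factorsAs test a′ a″ w)
  sumG-factorPFs {test} preserved a′ a″ w with positiveᵇ w in positive
  ... | false = ΣR-0 (factorPFs K test a′ a″) (λ _ → refl)
  ... | true  = begin
    ΣR K (map (λ a → indicator (eqWᵇ (Park w) a)) (factorPFs K test a′ a″))
      ≈⟨ ΣR-multiplicity (Park w) (factorPFs K test a′ a″) ⟩
    natR K (multiplicity (Park w) (factorPFs K test a′ a″))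
      ≡⟨ ≡.cong (natR K) (multiplicity-Park-factors preserved a′ a″ w positive) ⟩
    natR K (if factorsAs test a′ a″ w then 1 else 0)
      ≈⟨ natR-indicator _ ⟩
    indicator (factorsAs test a′ a″ w) ∎

  coefficient : ∀ {test} → PreservedByRank test → ∀ a′ a″ → 1 ≤ length a′ → 1 ≤ length a″ →
                _≈ₛ_ K (splitOp K test (G K a′) (G K a″)) (sumG K (factorPFs K test a′ a″))
  coefficient {test} preserved a′ a″ 1≤n′ 1≤n″ w =
    trans (splitOp-G test a′ a″ 1≤n′ 1≤n″ w) (sym (sumG-factorPFs preserved a′ a″ w))

  module _ (test : ℕ → ℕ → Bool) where

    private
      cuts : Word → List ℕ
      cuts w = applyUpTo (λ i → i) (length w ∸ 1)

      fits : Word → ℕ → Bool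
      fits w k = test (maxL (take (suc k) w)) (maxL (drop (suc k) w))

      term : Series K → Series K → Word → ℕ → Carrier
      term f g w k = if fits w k then f (take (suc k) w) * g (drop (suc k) w) else 0#

      if-cong : ∀ t {x y} → x ≈ y → (if t then x else 0#) ≈ (if t then y else 0#)
      if-cong true  x≈y = x≈y
      if-cong false _   = refl

      if-0 : ∀ t {x} → x ≈ 0# → (if t then x else 0#) ≈ 0#
      if-0 true  x≈0 = x≈0
      if-0 false _   = refl

      if-linear : ∀ t e {x y z} → x ≈ e * y + z →
                  (if t then x else 0#) ≈ e * (if t then y else 0#) + (if t then z else 0#)
      if-linear true  e x≈ = x≈
      if-linear false e _  = sym (trans (+-identityʳ _) (zeroʳ e))

      splitOp-linear : ∀ e f g f₁ g₁ f₂ g₂ w →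
        (∀ u v → f u * g v ≈ e * (f₁ u * g₁ v) + f₂ u * g₂ v) →
        splitOp K test f g w ≈ e * splitOp K test f₁ g₁ w + splitOp K test f₂ g₂ w
      splitOp-linear e f g f₁ g₁ f₂ g₂ w split = begin
        ΣR K (map (term f g w) (cuts w))
          ≈⟨ ΣR-cong (cuts w) (λ k → if-linear (fits w k) e (split _ _)) ⟩
        ΣR K (map (λ k → e * term f₁ g₁ w k + term f₂ g₂ w k) (cuts w))
          ≈⟨ ΣR-+ (λ k → e * term f₁ g₁ w k) (term f₂ g₂ w) (cuts w) ⟩
        ΣR K (map (λ k → e * term f₁ g₁ w k) (cuts w)) + ΣR K (map (term f₂ g₂ w) (cuts w))
          ≈⟨ +-congʳ (ΣR-* e (term f₁ g₁ w) (cuts w)) ⟩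
        e * ΣR K (map (term f₁ g₁ w) (cuts w)) + ΣR K (map (term f₂ g₂ w) (cuts w)) ∎

    splitOp-cong : ∀ {f f′ g g′} → _≈ₛ_ K f f′ → _≈ₛ_ K g g′ →
                   _≈ₛ_ K (splitOp K test f g) (splitOp K test f′ g′)
    splitOp-cong f≈ g≈ w = ΣR-cong (cuts w) (λ k → if-cong (fits w k) (*-cong (f≈ _) (g≈ _)))

    splitOp-linearˡ : ∀ e f₁ f₂ g w →
      splitOp K test (λ v → e * f₁ v + f₂ v) g w ≈ e * splitOp K test f₁ g w + splitOp K test f₂ g w
    splitOp-linearˡ e f₁ f₂ g w = splitOp-linear e _ g f₁ g f₂ g w
      (λ u v → trans (distribʳ (g v) (e * f₁ u) (f₂ u)) (+-congʳ (*-assoc e (f₁ u) (g v))))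

    splitOp-linearʳ : ∀ e f g₁ g₂ w →
      splitOp K test f (λ v → e * g₁ v + g₂ v) w ≈ e * splitOp K test f g₁ w + splitOp K test f g₂ w
    splitOp-linearʳ e f g₁ g₂ w = splitOp-linear e f _ f g₁ f g₂ w
      (λ u v → trans (distribˡ (f u) (e * g₁ v) (g₂ v))
                     (+-congʳ (x∙yz≈y∙xz *-commutativeSemigroup (f u) e (g₁ v))))

    splitOp-0ˡ : ∀ g w → splitOp K test (λ _ → 0#) g w ≈ 0#
    splitOp-0ˡ g w = ΣR-0 (cuts w) (λ k → if-0 (fits w k) (zeroˡ _))

    splitOp-0ʳ : ∀ f w → splitOp K test f (λ _ → 0#) w ≈ 0#
    splitOp-0ʳ f w = ΣR-0 (cuts w) (λ k → if-0 (fits w k) (zeroʳ _))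

  Good : Word → Set
  Good a = T (isParkingᵇ a) × 1 ≤ length a

  Terms : Set c
  Terms = List (Carrier × Word)

  combination : Terms → Series K
  combination []            w = 0#
  combination ((e , a) ∷ L) w = e * G K a w + combination L w

  ΣR≈combination : ∀ (F : Carrier × Word → Carrier) L w → (∀ e a → F (e , a) ≡ e * G K a w) →
                   ΣR K (map F L) ≈ combination L w
  ΣR≈combination F []            w _  = refl
  ΣR≈combination F ((e , a) ∷ L) w F≡ = +-cong (reflexive (F≡ e a)) (ΣR≈combination F L w F≡)

  combination-++ : ∀ L₁ L₂ w → combination (L₁ ++ L₂) w ≈ combination L₁ w + combination L₂ w
  combination-++ []             L₂ w = sym (+-identityˡ _)
  combination-++ ((e , a) ∷ L₁) L₂ w = trans (+-congˡ (combination-++ L₁ L₂ w)) (sym (+-assoc _ _ _))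

  combination-scale : ∀ e L w → combination (map (map₁ (e *_)) L) w ≈ e * combination L w
  combination-scale e []            w = sym (zeroʳ e)
  combination-scale e ((d , a) ∷ L) w =
    trans (+-cong (*-assoc e d _) (combination-scale e L w)) (sym (distribˡ e _ _))

  combination-sumG : ∀ d ps w → combination (map (d ,_) ps) w ≈ d * sumG K ps w
  combination-sumG d []       w = sym (zeroʳ d)
  combination-sumG d (p ∷ ps) w = trans (+-congˡ (combination-sumG d ps w)) (sym (distribˡ d _ _))

  module _ (test : ℕ → ℕ → Bool) where

    rowTerms : Word → Terms → Terms
    rowTerms a []            = []
    rowTerms a ((d , b) ∷ L) = map (d ,_) (factorPFs K test a b) ++ rowTerms a L

    productTerms : Terms → Terms → Terms
    productTerms []            L₂ = []
    productTerms ((e , a) ∷ L₁) L₂ = map (map₁ (e *_)) (rowTerms a L₂) ++ productTerms L₁ L₂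

    rowTerms-good : ∀ a L → 1 ≤ length a → All (Good ∘ proj₂) (rowTerms a L)
    rowTerms-good a []            _    = []
    rowTerms-good a ((d , b) ∷ L) 1≤n′ =
      ++⁺ (map⁺ (All.tabulate factor-good)) (rowTerms-good a L 1≤n′)
      where
      factor-good : ∀ {p} → p ∈ factorPFs K test a b → Good p
      factor-good p∈ with ∈-PFs (proj₁ (∈-filter⁻ (λ p → T? (factorsAs test a b p)) p∈))
      ... | parking , |p|≡ = parking , subst (1 ≤_) (≡.sym |p|≡) (≤-trans 1≤n′ (m≤m+n _ _))

    productTerms-good : ∀ L₁ L₂ → All (Good ∘ proj₂) L₁ → All (Good ∘ proj₂) (productTerms L₁ L₂)
    productTerms-good []             L₂ []                 = []
    productTerms-good ((e , a) ∷ L₁) L₂ ((_ , 1≤n′) ∷ good) =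
      ++⁺ (map⁺ (rowTerms-good a L₂ 1≤n′)) (productTerms-good L₁ L₂ good)

    module _ (preserved : PreservedByRank test) where

      splitOp-row : ∀ a L → 1 ≤ length a → All (Good ∘ proj₂) L →
                    _≈ₛ_ K (splitOp K test (G K a) (combination L)) (combination (rowTerms a L))
      splitOp-row a []            _    []                 w = splitOp-0ʳ test (G K a) w
      splitOp-row a ((d , b) ∷ L) 1≤n′ ((_ , 1≤n″) ∷ good) w = begin
        splitOp K test (G K a) (combination ((d , b) ∷ L)) w
          ≈⟨ splitOp-linearʳ test d (G K a) (G K b) (combination L) w ⟩
        d * splitOp K test (G K a) (G K b) w + splitOp K test (G K a) (combination L) w
          ≈⟨ +-cong (*-congˡ (coefficient preserved a b 1≤n′ 1≤n″ w)) (splitOp-row a L 1≤n′ good w) ⟩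
        d * sumG K (factorPFs K test a b) w + combination (rowTerms a L) w
          ≈⟨ +-congʳ (combination-sumG d (factorPFs K test a b) w) ⟨
        combination (map (d ,_) (factorPFs K test a b)) w + combination (rowTerms a L) w
          ≈⟨ combination-++ (map (d ,_) (factorPFs K test a b)) (rowTerms a L) w ⟨
        combination (rowTerms a ((d , b) ∷ L)) w ∎

      splitOp-combination : ∀ L₁ L₂ → All (Good ∘ proj₂) L₁ → All (Good ∘ proj₂) L₂ →
        _≈ₛ_ K (splitOp K test (combination L₁) (combination L₂)) (combination (productTerms L₁ L₂))
      splitOp-combination []             L₂ []                 _     w = splitOp-0ˡ test (combination L₂) w
      splitOp-combination ((e , a) ∷ L₁) L₂ ((_ , 1≤n′) ∷ good₁) good₂ w = begin
        splitOp K test (combination ((e , a) ∷ L₁)) (combination L₂) w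
          ≈⟨ splitOp-linearˡ test e (G K a) (combination L₁) (combination L₂) w ⟩
        e * splitOp K test (G K a) (combination L₂) w + splitOp K test (combination L₁) (combination L₂) w
          ≈⟨ +-cong (*-congˡ (splitOp-row a L₂ 1≤n′ good₂ w)) (splitOp-combination L₁ L₂ good₁ good₂ w) ⟩
        e * combination (rowTerms a L₂) w + combination (productTerms L₁ L₂) w
          ≈⟨ +-congʳ (combination-scale e (rowTerms a L₂) w) ⟨
        combination (map (map₁ (e *_)) (rowTerms a L₂)) w + combination (productTerms L₁ L₂) w
          ≈⟨ combination-++ (map (map₁ (e *_)) (rowTerms a L₂)) (productTerms L₁ L₂) w ⟨
        combination (productTerms ((e , a) ∷ L₁) L₂) w ∎

      splitOp-span : ∀ f g → InSpanG K f → InSpanG K g → InSpanG K (splitOp K test f g)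
      splitOp-span f g (L₁ , good₁ , f≈) (L₂ , good₂ , g≈) =
        productTerms L₁ L₂ ,
        All.lookup (productTerms-good L₁ L₂ (All.tabulate good₁)) ,
        λ w → begin
          splitOp K test f g w
            ≈⟨ splitOp-cong test (λ v → trans (f≈ v) (ΣR≈combination _ L₁ v (λ _ _ → ≡.refl)))
                                 (λ v → trans (g≈ v) (ΣR≈combination _ L₂ v (λ _ _ → ≡.refl))) w ⟩
          splitOp K test (combination L₁) (combination L₂) w
            ≈⟨ splitOp-combination L₁ L₂ (All.tabulate good₁) (All.tabulate good₂) w ⟩
          combination (productTerms L₁ L₂) w
            ≈⟨ ΣR≈combination _ (productTerms L₁ L₂) w (λ _ _ → ≡.refl) ⟨
          ΣR K (map (λ { (e , a) → e * G K a w }) (productTerms L₁ L₂)) ∎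

open Parkization using (>ᵇ-preserved; ≡ᵇ-preserved; <ᵇ-preserved)
open Coefficients using (coefficient; splitOp-span)

mainTheorem9 : ∀ {c ℓ : Level} (K : CommutativeRing c ℓ) → IsField K → CharZero K →
    ((a′ a″ : List ℕ) → T (isParkingᵇ a′) → 1 ≤ length a′ → T (isParkingᵇ a″) → 1 ≤ length a″ →
      (_≈ₛ_ K (_◁_ K (G K a′) (G K a″)) (sumG K (factorPFs K (λ m n → n <ᵇ m) a′ a″)))
      × (_≈ₛ_ K (_⊙_ K (G K a′) (G K a″)) (sumG K (factorPFs K (λ m n → m ≡ᵇ n) a′ a″)))
      × (_≈ₛ_ K (_▷_ K (G K a′) (G K a″)) (sumG K (factorPFs K (λ m n → m <ᵇ n) a′ a″))))
    × ((f g : Series K) → InSpanG K f → InSpanG K g →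
      InSpanG K (_◁_ K f g) × InSpanG K (_⊙_ K f g) × InSpanG K (_▷_ K f g))
mainTheorem9 K _ _ =
  (λ a′ a″ _ 1≤n′ _ 1≤n″ →
      coefficient K >ᵇ-preserved a′ a″ 1≤n′ 1≤n″
    , coefficient K ≡ᵇ-preserved a′ a″ 1≤n′ 1≤n″
    , coefficient K <ᵇ-preserved a′ a″ 1≤n′ 1≤n″) ,
  (λ f g f∈ g∈ →
      splitOp-span K _ >ᵇ-preserved f g f∈ g∈
    , splitOp-span K _ ≡ᵇ-preserved f g f∈ g∈
    , splitOp-span K _ <ᵇ-preserved f g f∈ g∈)
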